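{- Let $k,u,\ell$ be positive integers and let $\gamma=[k;\overline{u,\dots,u,2k}]$ be the infinite periodic continued fraction whose period consists of $\ell$ entries equal to $u$ followed by $2k$. Let $p_i/q_i$ be its convergents ($p_{ -1}=1,q_{ -1}=0,p_0=k,q_0=1$). Then $\gamma=\sqrt D$ for some $D\in\mathbb{N}$ if and only if $q_\ell\mid kp_\ell+p_{\ell-1}$. If $u$ and $q_\ell$ have the same parity, this condition is satisfied when $2k=q_\ell t+u$ with $t$ a positive integer, where $t$ is required to be odd if $u$ is odd; in this case $$D=k^2+tq_{\ell-1}+1=t^2\frac{q_\ell^2}{4}+t\,\frac{uq_\ell+2q_{\ell-1}}{2}+\frac{u^2}{4}+1,$$ and, writing $\alpha_i=p_i+q_i\sqrt D$, for $0\leq i\leq\ell$ we have $$N(\alpha_i)=p_i^2-Dq_i^2=(-1)^{i+1}\bigl(tq_iq_{\ell-i-1}+1\bigr).$$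
   Context: The convergents satisfy $p_{i+1}=a_{i+1}p_i+p_{i-1}$, $q_{i+1}=a_{i+1}q_i+q_{i-1}$ with partial quotients $a_0=k$, $a_1=\dots=a_\ell=u$, $a_{\ell+1}=2k$, repeating with period $\ell+1$. -}

module Defs where

open import Data.Nat using (ℕ; zero; suc; _+_; _*_; _∸_; _≤_; _<?_)
open import Data.Nat.DivMod using (_%_)
open import Data.Product using (_×_)
open import Relation.Nullary.Decidable using (does)
open import Data.Bool using (if_then_else_)

-- Partial quotients a_j of γ = [k; u,…,u (ℓ times), 2k, u,…,u, 2k, …]:
-- a_0 = k, and for j ≥ 1 the position in the period is (j-1) mod (ℓ+1);
-- positions 0..ℓ-1 give u, position ℓ gives 2k.
pq : ℕ → ℕ → ℕ → ℕ → ℕ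
pq k u ℓ zero    = k
pq k u ℓ (suc j) = if does ((j % suc ℓ) <? ℓ) then u else 2 * k

-- Shifted convergents: P n = p_{n-1}, Q n = q_{n-1}.
-- So P 0 = p_{-1} = 1, Q 0 = q_{-1} = 0, P 1 = p_0 = k, Q 1 = q_0 = 1, and
-- p_{i+1} = a_{i+1} p_i + p_{i-1}, q_{i+1} = a_{i+1} q_i + q_{i-1}.
P : ℕ → ℕ → ℕ → ℕ → ℕ
P k u ℓ zero = 1
P k u ℓ (suc zero) = k
P k u ℓ (suc (suc n)) = pq k u ℓ (suc n) * P k u ℓ (suc n) + P k u ℓ n

Q : ℕ → ℕ → ℕ → ℕ → ℕ
Q k u ℓ zero = 0
Q k u ℓ (suc zero) = 1
Q k u ℓ (suc (suc n)) = pq k u ℓ (suc n) * Q k u ℓ (suc n) + Q k u ℓ n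

p q : ℕ → ℕ → ℕ → ℕ → ℕ
p k u ℓ i = P k u ℓ (suc i)
q k u ℓ i = Q k u ℓ (suc i)

-- "γ = √D": the value γ of the (infinite, simple) continued fraction is the
-- unique real lying in every interval [p_{2i}/q_{2i}, p_{2i+1}/q_{2i+1}]
-- (nested-interval definition of the limit of the convergents).  Hence
-- γ = √D  iff  p_{2i}/q_{2i} ≤ √D ≤ p_{2i+1}/q_{2i+1} for all i, i.e.
-- (all quantities being nonnegative) p_{2i}² ≤ D q_{2i}² and
-- D q_{2i+1}² ≤ p_{2i+1}².
CFIsSqrt : ℕ → ℕ → ℕ → ℕ → Set
CFIsSqrt k u ℓ D = ∀ i →
  (p k u ℓ (2 * i) * p k u ℓ (2 * i) ≤ D * (q k u ℓ (2 * i) * q k u ℓ (2 * i)))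
  × (D * (q k u ℓ (suc (2 * i)) * q k u ℓ (suc (2 * i))) ≤ p k u ℓ (suc (2 * i)) * p k u ℓ (suc (2 * i)))

-- Write L = ℓ + 1 for the period and N = k p_ℓ + p_{ℓ−1}. Periodicity of the partial quotients
-- gives (p_{m+L}, q_{m+L}) = (p_ℓ p_m + N q_m, q_ℓ p_m + p_ℓ q_m), a substitution of determinant
-- p_ℓ² − q_ℓ N = (−1)^L; so the form q_ℓ P² − N Q² at the convergents is L-periodic up to sign,
-- i.e. γ = √(N/q_ℓ). If √D lies between all consecutive convergents then D q_ℓ = N, for otherwise
-- the bounded values of the form would have to exceed the squares of the growing denominators.
-- Conversely, in the first period q_m is the Lucas sequence U_{m+1}(u, −1) and p_m = k q_m + q_{m−1}.
-- As q_ℓ and q_{ℓ−1} are coprime, q_ℓ ∣ N forces 2k = q_ℓ t + u, and N = q_ℓ D for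
-- D = k² + t q_{ℓ−1} + 1. The Cassini and d'Ocagne identities for U then give
-- p_i² − D q_i² = (−1)^{i+1} (t q_i q_{ℓ−i−1} + 1) for i ≤ ℓ, and this sign pattern,
-- propagated by periodicity, puts √D between consecutive convergents.

module Submission where

open import Defs
open import Data.Nat using (ℕ; zero; suc; _+_; _*_; _∸_; _≤_; _<_; _<?_; s≤s; z≤n; NonZero; >-nonZero)
import Data.Nat.Properties as ℕ
open import Data.Nat.Coprimality using (Coprime; coprime-divisor)
open import Data.Nat.Divisibility using (_∣_; divides; quotient; ∣m+n∣m⇒∣n; ∣n⇒∣m*n; n∣m*n; ∣1⇒≡1; ∣⇒≤; ∣-refl)
open import Data.Nat.DivMod using (_%_; _/_; m<n⇒m%n≡m; [m+n]%n≡m%n; m≡m%n+[m/n]*n; m%n<n)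
import Data.Nat.Tactic.RingSolver as ℕ-Ring
open import Data.Integer using (ℤ; +_; -1ℤ; 0ℤ; 1ℤ; _^_; +≤+)
  renaming (_*_ to _*ℤ_; _-_ to _-ℤ_; _+_ to _+ℤ_; _≤_ to _≤ℤ_)
import Data.Integer.Properties as ℤ
import Data.Integer.Tactic.RingSolver as ℤ-Ring
open import Data.Empty using (⊥-elim)
open import Data.Product using (_×_; Σ; ∃-syntax; _,_; proj₁; proj₂)
open import Function.Base using (_∘_; case_of_)
open import Function.Bundles using (_⇔_; mk⇔)
open import Relation.Binary.PropositionalEquality
open import Relation.Nullary using (¬_; yes; no)
open import Relation.Nullary.Decidable using (dec-true; dec-false)

Recurrence : (ℕ → ℕ) → (ℕ → ℕ) → Set
Recurrence c X = ∀ m → X (2 + m) ≡ c m * X (1 + m) + X m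

RecurrenceUpTo : ℕ → (ℕ → ℕ) → (ℕ → ℕ) → Set
RecurrenceUpTo n c X = ∀ m → 2 + m ≤ n → X (2 + m) ≡ c m * X (1 + m) + X m

recurrence-unique : ∀ n c X Y → RecurrenceUpTo n c X → RecurrenceUpTo n c Y →
                    X 0 ≡ Y 0 → X 1 ≡ Y 1 → ∀ m → m ≤ n → X m ≡ Y m
recurrence-unique n c X Y recX recY X₀≡Y₀ X₁≡Y₁ = agree
  where
  agree : ∀ m → m ≤ n → X m ≡ Y m
  agree zero          _     = X₀≡Y₀
  agree (suc zero)    _     = X₁≡Y₁
  agree (suc (suc m)) m+2≤n = begin
    X (2 + m)              ≡⟨ recX m m+2≤n ⟩
    c m * X (1 + m) + X m  ≡⟨ cong₂ (λ x y → c m * x + y) (agree (suc m) (ℕ.<⇒≤ m+2≤n))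
                                                          (agree m (ℕ.m+n≤o⇒n≤o 2 m+2≤n)) ⟩
    c m * Y (1 + m) + Y m  ≡⟨ recY m m+2≤n ⟨
    Y (2 + m)              ∎
    where open ≡-Reasoning

recurrence-combination : ∀ α β c X Y → Recurrence c X → Recurrence c Y →
                         Recurrence c (λ m → α * X m + β * Y m)
recurrence-combination α β c X Y recX recY m
  rewrite recX m | recY m = regroup α β (c m) (X (1 + m)) (X m) (Y (1 + m)) (Y m)
  where
  regroup : ∀ α β c x₁ x₀ y₁ y₀ →
            α * (c * x₁ + x₀) + β * (c * y₁ + y₀) ≡ c * (α * x₁ + β * y₁) + (α * x₀ + β * y₀)
  regroup = ℕ-Ring.solve-∀

recurrence-coprime : ∀ c X → Recurrence c X → X 1 ≡ 1 → ∀ n → Coprime (X (suc n)) (X n)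
recurrence-coprime c X recX X₁≡1 zero    (d∣X₁ , _)   = ∣1⇒≡1 (subst (_ ∣_) X₁≡1 d∣X₁)
recurrence-coprime c X recX X₁≡1 (suc n) (d∣X₂ , d∣X₁) =
  recurrence-coprime c X recX X₁≡1 n
    (d∣X₁ , ∣m+n∣m⇒∣n (subst (_ ∣_) (recX n) d∣X₂) (∣n⇒∣m*n (c n) d∣X₁))

pos-*+ : ∀ a x b → + (a * x + b) ≡ + a *ℤ + x +ℤ + b
pos-*+ a x b = trans (ℤ.pos-+ (a * x) b) (cong (_+ℤ + b) (ℤ.pos-* a x))

pos-*+* : ∀ a x b y → + (a * x + b * y) ≡ + a *ℤ + x +ℤ + b *ℤ + y
pos-*+* a x b y = trans (ℤ.pos-+ (a * x) (b * y)) (cong₂ _+ℤ_ (ℤ.pos-* a x) (ℤ.pos-* b y))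

pos-*² : ∀ a x → + (a * (x * x)) ≡ + a *ℤ (+ x *ℤ + x)
pos-*² a x = trans (ℤ.pos-* a (x * x)) (cong (+ a *ℤ_) (ℤ.pos-* x x))

pos-diff-injective : ∀ {a b c d} → + a -ℤ + b ≡ + c -ℤ + d → a + d ≡ c + b
pos-diff-injective {a} {b} {c} {d} eq = ℤ.+-injective (begin
  + (a + d)                    ≡⟨ ℤ.pos-+ a d ⟩
  + a +ℤ + d                   ≡⟨ cancelʳ (+ a) (+ b) (+ d) ⟨
  (+ a -ℤ + b) +ℤ (+ d +ℤ + b) ≡⟨ cong (_+ℤ (+ d +ℤ + b)) eq ⟩
  (+ c -ℤ + d) +ℤ (+ d +ℤ + b) ≡⟨ cancelˡ (+ c) (+ d) (+ b) ⟩
  + c +ℤ + b                   ≡⟨ ℤ.pos-+ c b ⟨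
  + (c + b)                    ∎)
  where
  open ≡-Reasoning
  cancelʳ : ∀ x y z → (x -ℤ y) +ℤ (z +ℤ y) ≡ x +ℤ z
  cancelʳ = ℤ-Ring.solve-∀
  cancelˡ : ∀ x y z → (x -ℤ y) +ℤ (y +ℤ z) ≡ x +ℤ z
  cancelˡ = ℤ-Ring.solve-∀

0≤pos-diff⇒≤ : ∀ {a b} → 0ℤ ≤ℤ + a -ℤ + b → b ≤ a
0≤pos-diff⇒≤ = ℤ.drop‿+≤+ ∘ ℤ.0≤i-j⇒j≤i

0≤-pos-diff⇒≤ : ∀ {a b} → 0ℤ ≤ℤ -1ℤ *ℤ (+ a -ℤ + b) → a ≤ b
0≤-pos-diff⇒≤ {a} {b} = 0≤pos-diff⇒≤ ∘ subst (0ℤ ≤ℤ_) (negate (+ a) (+ b))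
  where
  negate : ∀ x y → -1ℤ *ℤ (x -ℤ y) ≡ y -ℤ x
  negate = ℤ-Ring.solve-∀

-1^n*-1^n≡1 : ∀ n → -1ℤ ^ n *ℤ -1ℤ ^ n ≡ 1ℤ
-1^n*-1^n≡1 zero    = refl
-1^n*-1^n≡1 (suc n) = trans (swap (-1ℤ ^ n)) (-1^n*-1^n≡1 n)
  where
  swap : ∀ s → (-1ℤ *ℤ s) *ℤ (-1ℤ *ℤ s) ≡ s *ℤ s
  swap = ℤ-Ring.solve-∀

-1^[2n]≡1 : ∀ n → -1ℤ ^ (2 * n) ≡ 1ℤ
-1^[2n]≡1 n = trans (sym (ℤ.^-*-assoc -1ℤ 2 n)) (ℤ.^-zeroˡ n)

casoratian : (ℕ → ℕ) → (ℕ → ℕ) → ℕ → ℤ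
casoratian X Y m = + X (suc m) *ℤ + Y m -ℤ + X m *ℤ + Y (suc m)

casoratian-alternates : ∀ c X Y → Recurrence c X → Recurrence c Y →
                        ∀ m → casoratian X Y m ≡ -1ℤ ^ m *ℤ casoratian X Y 0
casoratian-alternates c X Y recX recY zero = sym (ℤ.*-identityˡ _)
casoratian-alternates c X Y recX recY (suc m) = begin
  + X (2 + m) *ℤ + Y (1 + m) -ℤ + X (1 + m) *ℤ + Y (2 + m)
    ≡⟨ cong₂ (λ x y → x *ℤ + Y (1 + m) -ℤ + X (1 + m) *ℤ y)
             (trans (cong +_ (recX m)) (pos-*+ (c m) _ _)) (trans (cong +_ (recY m)) (pos-*+ (c m) _ _)) ⟩
  (+ c m *ℤ + X (1 + m) +ℤ + X m) *ℤ + Y (1 + m) -ℤ + X (1 + m) *ℤ (+ c m *ℤ + Y (1 + m) +ℤ + Y m)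
    ≡⟨ flip (+ c m) (+ X (1 + m)) (+ X m) (+ Y (1 + m)) (+ Y m) ⟩
  -1ℤ *ℤ casoratian X Y m
    ≡⟨ cong (-1ℤ *ℤ_) (casoratian-alternates c X Y recX recY m) ⟩
  -1ℤ *ℤ (-1ℤ ^ m *ℤ casoratian X Y 0)
    ≡⟨ ℤ.*-assoc -1ℤ (-1ℤ ^ m) (casoratian X Y 0) ⟨
  -1ℤ ^ suc m *ℤ casoratian X Y 0
    ∎
  where
  open ≡-Reasoning
  flip : ∀ c x₁ x₀ y₁ y₀ → (c *ℤ x₁ +ℤ x₀) *ℤ y₁ -ℤ x₁ *ℤ (c *ℤ y₁ +ℤ y₀) ≡ -1ℤ *ℤ (x₁ *ℤ y₀ -ℤ x₀ *ℤ y₁)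
  flip = ℤ-Ring.solve-∀

lucasU : ℕ → ℕ → ℕ
lucasU u zero          = 0
lucasU u (suc zero)    = 1
lucasU u (suc (suc n)) = u * lucasU u (suc n) + lucasU u n

lucasU-positive : ∀ {u} → 1 ≤ u → ∀ n → 1 ≤ lucasU u (suc n)
lucasU-positive u≥1 zero    = ℕ.≤-refl
lucasU-positive u≥1 (suc n) = ℕ.≤-trans (ℕ.*-mono-≤ u≥1 (lucasU-positive u≥1 n)) (ℕ.m≤m+n _ _)

lucasU-dOcagne : ∀ u r a → + lucasU u (suc a + r) *ℤ + lucasU u a -ℤ + lucasU u (a + r) *ℤ + lucasU u (suc a)
                             ≡ -1ℤ ^ suc a *ℤ + lucasU u r
lucasU-dOcagne u r a = begin
  casoratian (λ n → lucasU u (n + r)) (lucasU u) a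
    ≡⟨ casoratian-alternates (λ _ → u) (λ n → lucasU u (n + r)) (lucasU u) (λ _ → refl) (λ _ → refl) a ⟩
  -1ℤ ^ a *ℤ (+ lucasU u (suc r) *ℤ 0ℤ -ℤ + lucasU u r *ℤ 1ℤ)
    ≡⟨ initial (-1ℤ ^ a) (+ lucasU u (suc r)) (+ lucasU u r) ⟩
  -1ℤ ^ suc a *ℤ + lucasU u r
    ∎
  where
  open ≡-Reasoning
  initial : ∀ s x y → s *ℤ (x *ℤ 0ℤ -ℤ y *ℤ 1ℤ) ≡ (-1ℤ *ℤ s) *ℤ y
  initial = ℤ-Ring.solve-∀

lucasU-cassini : ∀ u a → + lucasU u (2 + a) *ℤ + lucasU u a -ℤ + lucasU u (1 + a) *ℤ + lucasU u (1 + a)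
                           ≡ -1ℤ ^ suc a
lucasU-cassini u a = begin
  casoratian (lucasU u ∘ suc) (lucasU u) a
    ≡⟨ casoratian-alternates (λ _ → u) (lucasU u ∘ suc) (lucasU u) (λ _ → refl) (λ _ → refl) a ⟩
  -1ℤ ^ a *ℤ (+ lucasU u 2 *ℤ 0ℤ -ℤ 1ℤ)
    ≡⟨ cong (λ x → -1ℤ ^ a *ℤ (x -ℤ 1ℤ)) (ℤ.*-zeroʳ (+ lucasU u 2)) ⟩
  -1ℤ ^ a *ℤ -1ℤ
    ≡⟨ ℤ.*-comm (-1ℤ ^ a) -1ℤ ⟩
  -1ℤ ^ suc a
    ∎
  where open ≡-Reasoning

offset-of-coprime-divisor : ∀ {M A B c u} → Coprime M A → 1 ≤ A → 1 ≤ c →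
                            M ≡ u * A + B → M ∣ c * A + B → ∃[ t ] c ≡ M * t + u
offset-of-coprime-divisor {M} {A} {B} {c} {u} M⊥A A≥1 c≥1 M≡ M∣cA+B with u ℕ.≤? c
... | yes u≤c = quotient M∣d , (begin
  c                   ≡⟨ ℕ.m+[n∸m]≡n u≤c ⟨
  u + d               ≡⟨ cong (λ x → u + x) (_∣_.equality M∣d) ⟩
  u + quotient M∣d * M ≡⟨ swap u (quotient M∣d) M ⟩
  M * quotient M∣d + u ∎)
  where
  open ≡-Reasoning
  d : ℕ
  d = c ∸ u
  cA+B≡M+dA : c * A + B ≡ M + A * d
  cA+B≡M+dA = begin
    c * A + B           ≡⟨ cong (λ x → x * A + B) (ℕ.m+[n∸m]≡n u≤c) ⟨
    (u + d) * A + B     ≡⟨ expand u d A B ⟩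
    (u * A + B) + A * d ≡⟨ cong (_+ A * d) M≡ ⟨
    M + A * d           ∎
    where
    expand : ∀ u d A B → (u + d) * A + B ≡ (u * A + B) + A * d
    expand = ℕ-Ring.solve-∀
  M∣d : M ∣ d
  M∣d = coprime-divisor M⊥A (∣m+n∣m⇒∣n (subst (M ∣_) cA+B≡M+dA M∣cA+B) ∣-refl)
  swap : ∀ u q M → u + q * M ≡ M * q + u
  swap = ℕ-Ring.solve-∀
... | no u≰c = ⊥-elim (ℕ.<⇒≱ cA+B<M (∣⇒≤ {{>-nonZero cA+B≥1}} M∣cA+B))
  where
  cA+B≥1 : 1 ≤ c * A + B
  cA+B≥1 = ℕ.≤-trans (ℕ.*-mono-≤ c≥1 A≥1) (ℕ.m≤m+n _ _)
  cA+B<M : c * A + B < M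
  cA+B<M = subst (c * A + B <_) (sym M≡)
             (ℕ.+-monoˡ-< B (ℕ.*-monoˡ-< A {{>-nonZero A≥1}} (ℕ.≰⇒> u≰c)))

gap-below : ∀ D M N P Q → D * M < N → P * P ≤ D * (Q * Q) → M * (P * P) + Q * Q ≤ N * (Q * Q)
gap-below D M N P Q DM<N P²≤DQ² = begin
  M * (P * P) + Q * Q       ≤⟨ ℕ.+-monoˡ-≤ (Q * Q) (ℕ.*-monoʳ-≤ M P²≤DQ²) ⟩
  M * (D * (Q * Q)) + Q * Q ≡⟨ regroup M D (Q * Q) ⟩
  suc (D * M) * (Q * Q)     ≤⟨ ℕ.*-monoˡ-≤ (Q * Q) DM<N ⟩
  N * (Q * Q)               ∎
  where
  open ℕ.≤-Reasoning
  regroup : ∀ M D S → M * (D * S) + S ≡ suc (D * M) * S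
  regroup = ℕ-Ring.solve-∀

gap-above : ∀ D M N P Q → N < D * M → D * (Q * Q) ≤ P * P → N * (Q * Q) + Q * Q ≤ M * (P * P)
gap-above D M N P Q N<DM DQ²≤P² = begin
  N * (Q * Q) + Q * Q       ≡⟨ ℕ.+-comm (N * (Q * Q)) (Q * Q) ⟩
  suc N * (Q * Q)           ≤⟨ ℕ.*-monoˡ-≤ (Q * Q) N<DM ⟩
  D * M * (Q * Q)           ≡⟨ regroup D M (Q * Q) ⟩
  M * (D * (Q * Q))         ≤⟨ ℕ.*-monoʳ-≤ M DQ²≤P² ⟩
  M * (P * P)               ∎
  where
  open ℕ.≤-Reasoning
  regroup : ∀ D M S → D * M * S ≡ M * (D * S)
  regroup = ℕ-Ring.solve-∀

square-not-below : ∀ {X Q} → X < Q → ¬ (Q * Q ≤ X)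
square-not-below {X} {suc Q} X<Q Q²≤X =
  ℕ.<⇒≱ X<Q (ℕ.≤-trans (ℕ.m≤m*n (suc Q) (suc Q)) Q²≤X)

continuant-norm-identity : ∀ (k t u a b M m r s : ℤ) →
  k +ℤ k ≡ M *ℤ t +ℤ u → M *ℤ b -ℤ m *ℤ a ≡ s *ℤ r → (u *ℤ a +ℤ b) *ℤ b -ℤ a *ℤ a ≡ s →
  (k *ℤ a +ℤ b) *ℤ (k *ℤ a +ℤ b) -ℤ (k *ℤ k +ℤ t *ℤ m +ℤ 1ℤ) *ℤ (a *ℤ a) ≡ s *ℤ (t *ℤ a *ℤ r +ℤ 1ℤ)
continuant-norm-identity k t u a b M m r s 2k≡Mt+u dOcagne cassini = begin
  (k *ℤ a +ℤ b) *ℤ (k *ℤ a +ℤ b) -ℤ (k *ℤ k +ℤ t *ℤ m +ℤ 1ℤ) *ℤ (a *ℤ a)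
    ≡⟨ expand k t a b m ⟩
  (k +ℤ k) *ℤ (a *ℤ b) +ℤ (b *ℤ b -ℤ a *ℤ a) -ℤ t *ℤ m *ℤ (a *ℤ a)
    ≡⟨ cong (λ x → x *ℤ (a *ℤ b) +ℤ (b *ℤ b -ℤ a *ℤ a) -ℤ t *ℤ m *ℤ (a *ℤ a)) 2k≡Mt+u ⟩
  (M *ℤ t +ℤ u) *ℤ (a *ℤ b) +ℤ (b *ℤ b -ℤ a *ℤ a) -ℤ t *ℤ m *ℤ (a *ℤ a)
    ≡⟨ regroup M t u a b m ⟩
  t *ℤ a *ℤ (M *ℤ b -ℤ m *ℤ a) +ℤ ((u *ℤ a +ℤ b) *ℤ b -ℤ a *ℤ a)
    ≡⟨ cong₂ (λ x y → t *ℤ a *ℤ x +ℤ y) dOcagne cassini ⟩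
  t *ℤ a *ℤ (s *ℤ r) +ℤ s
    ≡⟨ factor t a r s ⟩
  s *ℤ (t *ℤ a *ℤ r +ℤ 1ℤ)
    ∎
  where
  open ≡-Reasoning
  expand : ∀ k t a b m → (k *ℤ a +ℤ b) *ℤ (k *ℤ a +ℤ b) -ℤ (k *ℤ k +ℤ t *ℤ m +ℤ 1ℤ) *ℤ (a *ℤ a)
                         ≡ (k +ℤ k) *ℤ (a *ℤ b) +ℤ (b *ℤ b -ℤ a *ℤ a) -ℤ t *ℤ m *ℤ (a *ℤ a)
  expand = ℤ-Ring.solve-∀
  regroup : ∀ M t u a b m → (M *ℤ t +ℤ u) *ℤ (a *ℤ b) +ℤ (b *ℤ b -ℤ a *ℤ a) -ℤ t *ℤ m *ℤ (a *ℤ a)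
                            ≡ t *ℤ a *ℤ (M *ℤ b -ℤ m *ℤ a) +ℤ ((u *ℤ a +ℤ b) *ℤ b -ℤ a *ℤ a)
  regroup = ℤ-Ring.solve-∀
  factor : ∀ t a r s → t *ℤ a *ℤ (s *ℤ r) +ℤ s ≡ s *ℤ (t *ℤ a *ℤ r +ℤ 1ℤ)
  factor = ℤ-Ring.solve-∀

periodic-mod : ∀ {a} {A : Set a} (f : ℕ → A) n .{{_ : NonZero n}} →
               (∀ m → f (m + n) ≡ f m) → ∀ m → f m ≡ f (m % n)
periodic-mod f n f-periodic m = trans (cong f (m≡m%n+[m/n]*n m n)) (multiples (m / n))
  where
  multiples : ∀ c → f (m % n + c * n) ≡ f (m % n)
  multiples zero    = cong f (ℕ.+-identityʳ (m % n))
  multiples (suc c) = trans (cong f (regroup (m % n) c n)) (trans (f-periodic _) (multiples c))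
    where
    regroup : ∀ r c n → r + suc c * n ≡ r + c * n + n
    regroup = ℕ-Ring.solve-∀

module PeriodicExpansion (k u l : ℕ) (k≥1 : 1 ≤ k) (u≥1 : 1 ≤ u) where

  ℓ L : ℕ
  ℓ = suc l
  L = suc ℓ

  U P′ Q′ : ℕ → ℕ
  U  = lucasU u
  P′ = P k u ℓ
  Q′ = Q k u ℓ

  coeff : ℕ → ℕ
  coeff m = pq k u ℓ (suc m)

  P′-recurrence : Recurrence coeff P′
  P′-recurrence _ = refl

  Q′-recurrence : Recurrence coeff Q′
  Q′-recurrence _ = refl

  pq-firstPeriod : ∀ {m} → m < ℓ → pq k u ℓ (suc m) ≡ u
  pq-firstPeriod {m} m<ℓ rewrite m<n⇒m%n≡m (ℕ.m≤n⇒m≤1+n m<ℓ) | dec-true (m <? ℓ) m<ℓ = refl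

  pq-periodEnd : pq k u ℓ L ≡ 2 * k
  pq-periodEnd rewrite m<n⇒m%n≡m (ℕ.n<1+n ℓ) | dec-false (ℓ <? ℓ) (ℕ.n≮n ℓ) = refl

  pq-periodic : ∀ m → pq k u ℓ (suc (m + L)) ≡ pq k u ℓ (suc m)
  pq-periodic m rewrite [m+n]%n≡m%n m L {{_}} = refl

  Q-firstPeriod : ∀ m → m ≤ L → Q′ m ≡ U m
  Q-firstPeriod = recurrence-unique L coeff Q′ U (λ m _ → Q′-recurrence m) U-recurrence refl refl
    where
    U-recurrence : RecurrenceUpTo L coeff U
    U-recurrence m m+2≤L rewrite pq-firstPeriod (ℕ.≤-pred m+2≤L) = refl

  P-firstPeriod : ∀ m → m ≤ ℓ → P′ (suc m) ≡ k * Q′ (suc m) + Q′ m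
  P-firstPeriod m m≤ℓ = begin
    P′ (suc m)               ≡⟨ recurrence-unique ℓ (coeff ∘ suc) (P′ ∘ suc) (λ m → k * U (suc m) + U m)
                                  (λ m _ → P′-recurrence (suc m)) Y-recurrence (Y₀ k) (Y₁ k u) m m≤ℓ ⟩
    k * U (suc m) + U m      ≡⟨ cong₂ (λ x y → k * x + y) (Q-firstPeriod (suc m) (s≤s m≤ℓ))
                                                          (Q-firstPeriod m (ℕ.m≤n⇒m≤1+n m≤ℓ)) ⟨
    k * Q′ (suc m) + Q′ m    ∎
    where
    open ≡-Reasoning
    Y-recurrence : RecurrenceUpTo ℓ (coeff ∘ suc) (λ m → k * U (suc m) + U m)
    Y-recurrence m m+2≤ℓ rewrite pq-firstPeriod m+2≤ℓ = regroup k u (U (2 + m)) (U (1 + m)) (U m)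
      where
      regroup : ∀ k u a b c → k * (u * a + b) + (u * b + c) ≡ u * (k * a + b) + (k * b + c)
      regroup = ℕ-Ring.solve-∀
    Y₀ : ∀ k → k ≡ k * 1 + 0
    Y₀ = ℕ-Ring.solve-∀
    Y₁ : ∀ k u → u * k + 1 ≡ k * (u * 1 + 0) + 1
    Y₁ = ℕ-Ring.solve-∀

  pℓ qℓ pℓ₋₁ qℓ₋₁ qℓ₋₂ N : ℕ
  pℓ   = P′ L
  qℓ   = Q′ L
  pℓ₋₁ = P′ ℓ
  qℓ₋₁ = Q′ ℓ
  qℓ₋₂ = Q′ l
  N    = k * pℓ + pℓ₋₁

  pℓ≡ : pℓ ≡ k * qℓ + qℓ₋₁
  pℓ≡ = P-firstPeriod ℓ ℕ.≤-refl

  qℓ≡ : qℓ ≡ u * qℓ₋₁ + qℓ₋₂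
  qℓ≡ = cong (λ a → a * qℓ₋₁ + qℓ₋₂) (pq-firstPeriod (ℕ.n<1+n l))

  N-expansion : N ≡ k * k * qℓ + (2 * k * qℓ₋₁ + qℓ₋₂)
  N-expansion = begin
    k * pℓ + pℓ₋₁                           ≡⟨ cong₂ (λ x y → k * x + y) pℓ≡ (P-firstPeriod l (ℕ.n≤1+n l)) ⟩
    k * (k * qℓ + qℓ₋₁) + (k * qℓ₋₁ + qℓ₋₂) ≡⟨ expand k qℓ qℓ₋₁ qℓ₋₂ ⟩
    k * k * qℓ + (2 * k * qℓ₋₁ + qℓ₋₂)      ∎
    where
    open ≡-Reasoning
    expand : ∀ k q q′ q″ → k * (k * q + q′) + (k * q′ + q″) ≡ k * k * q + (2 * k * q′ + q″)
    expand = ℕ-Ring.solve-∀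

  qℓ₋₁≥1 : 1 ≤ qℓ₋₁
  qℓ₋₁≥1 = subst (1 ≤_) (sym (Q-firstPeriod ℓ (ℕ.n≤1+n ℓ))) (lucasU-positive u≥1 l)

  qℓ≥1 : 1 ≤ qℓ
  qℓ≥1 = subst (1 ≤_) (sym (Q-firstPeriod L ℕ.≤-refl)) (lucasU-positive u≥1 ℓ)

  instance
    k-nonZero : NonZero k
    k-nonZero = >-nonZero k≥1

    qℓ-nonZero : NonZero qℓ
    qℓ-nonZero = >-nonZero qℓ≥1

  qℓ<pℓ : qℓ < pℓ
  qℓ<pℓ = begin-strict
    qℓ             ≤⟨ ℕ.m≤n*m qℓ k ⟩
    k * qℓ         <⟨ ℕ.m<m+n (k * qℓ) qℓ₋₁≥1 ⟩
    k * qℓ + qℓ₋₁  ≡⟨ pℓ≡ ⟨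
    pℓ             ∎
    where open ℕ.≤-Reasoning

  N<P[L+1] : N < P′ (suc L)
  N<P[L+1] = begin-strict
    N                  <⟨ ℕ.m<n+m N (ℕ.*-mono-≤ k≥1 (ℕ.<⇒≤ (ℕ.≤-<-trans qℓ≥1 qℓ<pℓ))) ⟩
    k * pℓ + N         ≡⟨ regroup k pℓ pℓ₋₁ ⟩
    2 * k * pℓ + pℓ₋₁  ≡⟨ cong (λ a → a * pℓ + pℓ₋₁) pq-periodEnd ⟨
    P′ (suc L)         ∎
    where
    open ℕ.≤-Reasoning
    regroup : ∀ k p p′ → k * p + (k * p + p′) ≡ 2 * k * p + p′
    regroup = ℕ-Ring.solve-∀

  offset-exists : qℓ ∣ N → ∃[ t ] 2 * k ≡ qℓ * t + u
  offset-exists qℓ∣N =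
    offset-of-coprime-divisor (recurrence-coprime coeff Q′ Q′-recurrence refl ℓ) qℓ₋₁≥1
      (ℕ.*-mono-≤ {1} {2} (s≤s z≤n) k≥1) qℓ≡
      (∣m+n∣m⇒∣n (subst (qℓ ∣_) N-expansion qℓ∣N) (n∣m*n (k * k)))

  unit-determinant : + pℓ *ℤ + pℓ -ℤ + qℓ *ℤ + N ≡ -1ℤ ^ L
  unit-determinant = begin
    + pℓ *ℤ + pℓ -ℤ + qℓ *ℤ + N
      ≡⟨ cong (λ n → + pℓ *ℤ + pℓ -ℤ + qℓ *ℤ n) (pos-*+ k pℓ pℓ₋₁) ⟩
    + pℓ *ℤ + pℓ -ℤ + qℓ *ℤ (+ k *ℤ + pℓ +ℤ + pℓ₋₁)
      ≡⟨ eliminate-k (+ k) (+ qℓ) (+ qℓ₋₁) (+ pℓ₋₁) (trans (cong +_ pℓ≡) (pos-*+ k qℓ qℓ₋₁)) ⟩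
    casoratian P′ Q′ ℓ
      ≡⟨ casoratian-alternates coeff P′ Q′ P′-recurrence Q′-recurrence ℓ ⟩
    -1ℤ ^ ℓ *ℤ (+ k *ℤ 0ℤ -ℤ 1ℤ)
      ≡⟨ cong (λ x → -1ℤ ^ ℓ *ℤ (x -ℤ 1ℤ)) (ℤ.*-zeroʳ (+ k)) ⟩
    -1ℤ ^ ℓ *ℤ -1ℤ
      ≡⟨ ℤ.*-comm (-1ℤ ^ ℓ) -1ℤ ⟩
    -1ℤ ^ L
      ∎
    where
    open ≡-Reasoning
    identity : ∀ k q q′ p′ → (k *ℤ q +ℤ q′) *ℤ (k *ℤ q +ℤ q′) -ℤ q *ℤ (k *ℤ (k *ℤ q +ℤ q′) +ℤ p′)
                             ≡ (k *ℤ q +ℤ q′) *ℤ q′ -ℤ p′ *ℤ q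
    identity = ℤ-Ring.solve-∀
    eliminate-k : ∀ {p} k q q′ p′ → p ≡ k *ℤ q +ℤ q′ → p *ℤ p -ℤ q *ℤ (k *ℤ p +ℤ p′) ≡ p *ℤ q′ -ℤ p′ *ℤ q
    eliminate-k k q q′ p′ refl = identity k q q′ p′

  shift-by-period : ∀ {X} β → Recurrence coeff X → β ≡ k * X L + X ℓ →
                    ∀ m → X (m + L) ≡ X L * P′ m + β * Q′ m
  shift-by-period {X} β recX β≡ m =
    recurrence-unique m coeff (λ m → X (m + L)) (λ m → X L * P′ m + β * Q′ m)
      (λ m _ → trans (recX (m + L)) (cong (λ c → c * X (suc m + L) + X (m + L)) (pq-periodic m)))
      (λ m _ → recurrence-combination (X L) β coeff P′ Q′ P′-recurrence Q′-recurrence m)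
      (initial (X L) β) X₁ m ℕ.≤-refl
    where
    open ≡-Reasoning
    initial : ∀ a b → a ≡ a * 1 + b * 0
    initial = ℕ-Ring.solve-∀
    next : ∀ k a a′ → 2 * k * a + a′ ≡ a * k + (k * a + a′) * 1
    next = ℕ-Ring.solve-∀
    X₁ : X (suc L) ≡ X L * k + β * 1
    X₁ = begin
      X (suc L)                      ≡⟨ recX ℓ ⟩
      pq k u ℓ L * X L + X ℓ         ≡⟨ cong (λ a → a * X L + X ℓ) pq-periodEnd ⟩
      2 * k * X L + X ℓ              ≡⟨ next k (X L) (X ℓ) ⟩
      X L * k + (k * X L + X ℓ) * 1  ≡⟨ cong (λ b → X L * k + b * 1) β≡ ⟨
      X L * k + β * 1                ∎

  P-shift : ∀ m → P′ (m + L) ≡ pℓ * P′ m + N * Q′ m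
  P-shift = shift-by-period N P′-recurrence refl

  Q-shift : ∀ m → Q′ (m + L) ≡ qℓ * P′ m + pℓ * Q′ m
  Q-shift = shift-by-period pℓ Q′-recurrence pℓ≡

  Q-dOcagne : ∀ i → i ≤ ℓ → + qℓ *ℤ + Q′ i -ℤ + qℓ₋₁ *ℤ + Q′ (suc i) ≡ -1ℤ ^ suc i *ℤ + Q′ (ℓ ∸ i)
  Q-dOcagne i i≤ℓ = begin
    + qℓ *ℤ + Q′ i -ℤ + qℓ₋₁ *ℤ + Q′ (suc i)
      ≡⟨ cong₂ _-ℤ_ (cong₂ _*ℤ_ (Q≡U ℕ.≤-refl) (Q≡U (ℕ.m≤n⇒m≤1+n i≤ℓ)))
                    (cong₂ _*ℤ_ (Q≡U (ℕ.n≤1+n ℓ)) (Q≡U (s≤s i≤ℓ))) ⟩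
    + U L *ℤ + U i -ℤ + U ℓ *ℤ + U (suc i)
      ≡⟨ subst₂ (λ x y → + U x *ℤ + U i -ℤ + U y *ℤ + U (suc i) ≡ -1ℤ ^ suc i *ℤ + U (ℓ ∸ i))
                (cong suc (ℕ.m+[n∸m]≡n i≤ℓ)) (ℕ.m+[n∸m]≡n i≤ℓ) (lucasU-dOcagne u (ℓ ∸ i) i) ⟩
    -1ℤ ^ suc i *ℤ + U (ℓ ∸ i)
      ≡⟨ cong (-1ℤ ^ suc i *ℤ_) (Q≡U (ℕ.m≤n⇒m≤1+n (ℕ.m∸n≤m ℓ i))) ⟨
    -1ℤ ^ suc i *ℤ + Q′ (ℓ ∸ i)
      ∎
    where
    open ≡-Reasoning
    Q≡U : ∀ {m} → m ≤ L → + Q′ m ≡ + U m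
    Q≡U {m} m≤L = cong +_ (Q-firstPeriod m m≤L)

  Q-cassini : ∀ i → i ≤ ℓ →
              + (u * Q′ (suc i) + Q′ i) *ℤ + Q′ i -ℤ + Q′ (suc i) *ℤ + Q′ (suc i) ≡ -1ℤ ^ suc i
  Q-cassini i i≤ℓ
    rewrite Q-firstPeriod (suc i) (s≤s i≤ℓ) | Q-firstPeriod i (ℕ.m≤n⇒m≤1+n i≤ℓ) = lucasU-cassini u i

  form : ℕ → ℤ
  form m = + (qℓ * (P′ m * P′ m)) -ℤ + (N * (Q′ m * Q′ m))

  form-ℤ : ∀ m → form m ≡ + qℓ *ℤ (+ P′ m *ℤ + P′ m) -ℤ + N *ℤ (+ Q′ m *ℤ + Q′ m)
  form-ℤ m = cong₂ _-ℤ_ (pos-*² qℓ (P′ m)) (pos-*² N (Q′ m))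

  form-shift : ∀ m → form (m + L) ≡ -1ℤ ^ L *ℤ form m
  form-shift m = begin
    form (m + L)
      ≡⟨ form-ℤ (m + L) ⟩
    + qℓ *ℤ (+ P′ (m + L) *ℤ + P′ (m + L)) -ℤ + N *ℤ (+ Q′ (m + L) *ℤ + Q′ (m + L))
      ≡⟨ cong₂ (λ x y → + qℓ *ℤ (x *ℤ x) -ℤ + N *ℤ (y *ℤ y))
               (trans (cong +_ (P-shift m)) (pos-*+* pℓ (P′ m) N (Q′ m)))
               (trans (cong +_ (Q-shift m)) (pos-*+* qℓ (P′ m) pℓ (Q′ m))) ⟩
    + qℓ *ℤ ((+ pℓ *ℤ + P′ m +ℤ + N *ℤ + Q′ m) *ℤ (+ pℓ *ℤ + P′ m +ℤ + N *ℤ + Q′ m))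
      -ℤ + N *ℤ ((+ qℓ *ℤ + P′ m +ℤ + pℓ *ℤ + Q′ m) *ℤ (+ qℓ *ℤ + P′ m +ℤ + pℓ *ℤ + Q′ m))
      ≡⟨ transform (+ qℓ) (+ N) (+ pℓ) (+ P′ m) (+ Q′ m) ⟩
    (+ pℓ *ℤ + pℓ -ℤ + qℓ *ℤ + N) *ℤ (+ qℓ *ℤ (+ P′ m *ℤ + P′ m) -ℤ + N *ℤ (+ Q′ m *ℤ + Q′ m))
      ≡⟨ cong₂ _*ℤ_ unit-determinant (sym (form-ℤ m)) ⟩
    -1ℤ ^ L *ℤ form m
      ∎
    where
    open ≡-Reasoning
    transform : ∀ M N x p q →
      M *ℤ ((x *ℤ p +ℤ N *ℤ q) *ℤ (x *ℤ p +ℤ N *ℤ q)) -ℤ N *ℤ ((M *ℤ p +ℤ x *ℤ q) *ℤ (M *ℤ p +ℤ x *ℤ q))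
        ≡ (x *ℤ x -ℤ M *ℤ N) *ℤ (M *ℤ (p *ℤ p) -ℤ N *ℤ (q *ℤ q))
    transform = ℤ-Ring.solve-∀

  form-doubleShift : ∀ m → form (m + L + L) ≡ form m
  form-doubleShift m = begin
    form (m + L + L)                        ≡⟨ form-shift (m + L) ⟩
    -1ℤ ^ L *ℤ form (m + L)                 ≡⟨ cong (-1ℤ ^ L *ℤ_) (form-shift m) ⟩
    -1ℤ ^ L *ℤ (-1ℤ ^ L *ℤ form m)          ≡⟨ ℤ.*-assoc (-1ℤ ^ L) (-1ℤ ^ L) (form m) ⟨
    (-1ℤ ^ L *ℤ -1ℤ ^ L) *ℤ form m          ≡⟨ cong (_*ℤ form m) (-1^n*-1^n≡1 L) ⟩
    1ℤ *ℤ form m                            ≡⟨ ℤ.*-identityˡ (form m) ⟩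
    form m                                  ∎
    where open ≡-Reasoning

  P≤Q[+L] : ∀ m → P′ m ≤ Q′ (m + L)
  P≤Q[+L] m = subst (P′ m ≤_) (sym (Q-shift m)) (ℕ.≤-trans (ℕ.m≤n*m (P′ m) qℓ) (ℕ.m≤m+n _ _))

  -- At the indices 2L and 2L + 1 the form takes its initial values q_ℓ and q_ℓ k² − N, which are
  -- too small against the squared denominators for √D to lie on the wrong side of √(N/q_ℓ).
  module _ {D : ℕ} (isSqrt : CFIsSqrt k u ℓ D) where

    private
      Pₒ Qₒ Pₑ Qₑ : ℕ
      Pₒ = P′ (L + L)
      Qₒ = Q′ (L + L)
      Pₑ = P′ (suc L + L)
      Qₑ = Q′ (suc L + L)

      upper : D * (Qₒ * Qₒ) ≤ Pₒ * Pₒ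
      upper = subst (λ j → D * (Q′ j * Q′ j) ≤ P′ j * P′ j) (index ℓ) (proj₂ (isSqrt ℓ))
        where
        index : ∀ n → suc (suc (2 * n)) ≡ suc n + suc n
        index = ℕ-Ring.solve-∀

      lower : Pₑ * Pₑ ≤ D * (Qₑ * Qₑ)
      lower = subst (λ j → P′ j * P′ j ≤ D * (Q′ j * Q′ j)) (index L) (proj₁ (isSqrt L))
        where
        index : ∀ n → suc (2 * n) ≡ suc n + n
        index = ℕ-Ring.solve-∀

    not-above : ¬ (N < D * qℓ)
    not-above N<Dqℓ = square-not-below (ℕ.<-≤-trans qℓ<pℓ (P≤Q[+L] L)) Qₒ²≤qℓ
      where
      open ℕ.≤-Reasoning
      regroup : ∀ a b → a * 1 + b ≡ b + a
      regroup = ℕ-Ring.solve-∀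
      Qₒ²≤qℓ : Qₒ * Qₒ ≤ qℓ
      Qₒ²≤qℓ = ℕ.+-cancelˡ-≤ (N * (Qₒ * Qₒ)) _ _ (begin
        N * (Qₒ * Qₒ) + Qₒ * Qₒ    ≤⟨ gap-above D qℓ N Pₒ Qₒ N<Dqℓ upper ⟩
        qℓ * (Pₒ * Pₒ)             ≤⟨ ℕ.m≤m+n _ _ ⟩
        qℓ * (Pₒ * Pₒ) + N * 0     ≡⟨ pos-diff-injective {c = qℓ * 1} {N * 0} (form-doubleShift 0) ⟩
        qℓ * 1 + N * (Qₒ * Qₒ)     ≡⟨ regroup qℓ (N * (Qₒ * Qₒ)) ⟩
        N * (Qₒ * Qₒ) + qℓ         ∎)

    not-below : ¬ (D * qℓ < N)
    not-below Dqℓ<N = square-not-below (ℕ.<-≤-trans N<P[L+1] (P≤Q[+L] (suc L))) Qₑ²≤N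
      where
      open ℕ.≤-Reasoning
      Qₑ²≤N : Qₑ * Qₑ ≤ N
      Qₑ²≤N = ℕ.+-cancelˡ-≤ (qℓ * (Pₑ * Pₑ)) _ _ (begin
        qℓ * (Pₑ * Pₑ) + Qₑ * Qₑ      ≤⟨ gap-below D qℓ N Pₑ Qₑ Dqℓ<N lower ⟩
        N * (Qₑ * Qₑ)                 ≤⟨ ℕ.m≤n+m _ _ ⟩
        qℓ * (k * k) + N * (Qₑ * Qₑ)  ≡⟨ pos-diff-injective {c = qℓ * (k * k)} {N * 1} (form-doubleShift 1) ⟨
        qℓ * (Pₑ * Pₑ) + N * 1        ≡⟨ cong (λ x → qℓ * (Pₑ * Pₑ) + x) (ℕ.*-identityʳ N) ⟩
        qℓ * (Pₑ * Pₑ) + N            ∎)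

    D*qℓ≡N : D * qℓ ≡ N
    D*qℓ≡N = ℕ.≤-antisym (ℕ.≮⇒≥ not-above) (ℕ.≮⇒≥ not-below)

  module ClosedForm (t : ℕ) (2k≡qℓt+u : 2 * k ≡ qℓ * t + u) where

    D₀ : ℕ
    D₀ = k * k + t * qℓ₋₁ + 1

    N≡qℓ*D₀ : N ≡ qℓ * D₀
    N≡qℓ*D₀ = begin
      N                                                 ≡⟨ N-expansion ⟩
      k * k * qℓ + (2 * k * qℓ₋₁ + qℓ₋₂)                ≡⟨ cong (λ c → k * k * qℓ + (c * qℓ₋₁ + qℓ₋₂)) 2k≡qℓt+u ⟩
      k * k * qℓ + ((qℓ * t + u) * qℓ₋₁ + qℓ₋₂)         ≡⟨ regroup k qℓ t u qℓ₋₁ qℓ₋₂ ⟩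
      k * k * qℓ + (qℓ * t * qℓ₋₁ + (u * qℓ₋₁ + qℓ₋₂))  ≡⟨ cong (λ q → k * k * qℓ + (qℓ * t * qℓ₋₁ + q)) qℓ≡ ⟨
      k * k * qℓ + (qℓ * t * qℓ₋₁ + qℓ)                 ≡⟨ factor k qℓ t qℓ₋₁ ⟩
      qℓ * D₀                                           ∎
      where
      open ≡-Reasoning
      regroup : ∀ k q t u q′ q″ →
                k * k * q + ((q * t + u) * q′ + q″) ≡ k * k * q + (q * t * q′ + (u * q′ + q″))
      regroup = ℕ-Ring.solve-∀
      factor : ∀ k q t q′ → k * k * q + (q * t * q′ + q) ≡ q * (k * k + t * q′ + 1)
      factor = ℕ-Ring.solve-∀

    sqrt-unique : ∀ {D} → CFIsSqrt k u ℓ D → D ≡ D₀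
    sqrt-unique {D} isSqrt =
      ℕ.*-cancelʳ-≡ D D₀ qℓ (trans (D*qℓ≡N {D} isSqrt) (trans N≡qℓ*D₀ (ℕ.*-comm qℓ D₀)))

    four-D₀ : 4 * D₀ ≡ t * t * (qℓ * qℓ) + 2 * t * (u * qℓ + 2 * qℓ₋₁) + u * u + 4
    four-D₀ = begin
      4 * D₀                                                    ≡⟨ double k t qℓ₋₁ ⟩
      2 * k * (2 * k) + 4 * t * qℓ₋₁ + 4                        ≡⟨ cong (λ c → c * c + 4 * t * qℓ₋₁ + 4) 2k≡qℓt+u ⟩
      (qℓ * t + u) * (qℓ * t + u) + 4 * t * qℓ₋₁ + 4            ≡⟨ expand qℓ t u qℓ₋₁ ⟩
      t * t * (qℓ * qℓ) + 2 * t * (u * qℓ + 2 * qℓ₋₁) + u * u + 4 ∎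
      where
      open ≡-Reasoning
      double : ∀ k t q → 4 * (k * k + t * q + 1) ≡ 2 * k * (2 * k) + 4 * t * q + 4
      double = ℕ-Ring.solve-∀
      expand : ∀ q t u q′ → (q * t + u) * (q * t + u) + 4 * t * q′ + 4
                              ≡ t * t * (q * q) + 2 * t * (u * q + 2 * q′) + u * u + 4
      expand = ℕ-Ring.solve-∀

    norm : ℕ → ℤ
    norm m = + (P′ m * P′ m) -ℤ + (D₀ * (Q′ m * Q′ m))

    norm-ℤ : ∀ m → norm m ≡ + P′ m *ℤ + P′ m -ℤ + D₀ *ℤ (+ Q′ m *ℤ + Q′ m)
    norm-ℤ m = cong₂ _-ℤ_ (ℤ.pos-* (P′ m) (P′ m)) (pos-*² D₀ (Q′ m))

    norm-formula : ∀ i → i ≤ ℓ → norm (suc i) ≡ -1ℤ ^ suc i *ℤ + (t * Q′ (suc i) * Q′ (ℓ ∸ i) + 1)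
    norm-formula i i≤ℓ = begin
      norm (suc i)
        ≡⟨ norm-ℤ (suc i) ⟩
      + P′ (suc i) *ℤ + P′ (suc i) -ℤ + D₀ *ℤ (+ a *ℤ + a)
        ≡⟨ cong₂ (λ x d → x *ℤ x -ℤ d *ℤ (+ a *ℤ + a)) pᵢ-ℤ D₀-ℤ ⟩
      (+ k *ℤ + a +ℤ + b) *ℤ (+ k *ℤ + a +ℤ + b) -ℤ (+ k *ℤ + k +ℤ + t *ℤ + qℓ₋₁ +ℤ 1ℤ) *ℤ (+ a *ℤ + a)
        ≡⟨ continuant-norm-identity (+ k) (+ t) (+ u) (+ a) (+ b) (+ qℓ) (+ qℓ₋₁) (+ r) (-1ℤ ^ suc i)
             2k≡qℓt+u-ℤ (Q-dOcagne i i≤ℓ) cassini ⟩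
      -1ℤ ^ suc i *ℤ (+ t *ℤ + a *ℤ + r +ℤ 1ℤ)
        ≡⟨ cong (-1ℤ ^ suc i *ℤ_) tar+1-ℤ ⟨
      -1ℤ ^ suc i *ℤ + (t * a * r + 1)
        ∎
      where
      open ≡-Reasoning
      a b r : ℕ
      a = Q′ (suc i)
      b = Q′ i
      r = Q′ (ℓ ∸ i)
      pᵢ-ℤ : + P′ (suc i) ≡ + k *ℤ + a +ℤ + b
      pᵢ-ℤ = trans (cong +_ (P-firstPeriod i i≤ℓ)) (pos-*+ k a b)
      D₀-ℤ : + D₀ ≡ + k *ℤ + k +ℤ + t *ℤ + qℓ₋₁ +ℤ 1ℤ
      D₀-ℤ = trans (ℤ.pos-+ (k * k + t * qℓ₋₁) 1) (cong (_+ℤ 1ℤ) (pos-*+* k k t qℓ₋₁))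
      tar+1-ℤ : + (t * a * r + 1) ≡ + t *ℤ + a *ℤ + r +ℤ 1ℤ
      tar+1-ℤ = trans (ℤ.pos-+ (t * a * r) 1)
                      (cong (_+ℤ 1ℤ) (trans (ℤ.pos-* (t * a) r) (cong (_*ℤ + r) (ℤ.pos-* t a))))
      2k≡qℓt+u-ℤ : + k +ℤ + k ≡ + qℓ *ℤ + t +ℤ + u
      2k≡qℓt+u-ℤ = trans (sym (ℤ.pos-+ k k)) (trans (cong +_ (trans (double k) 2k≡qℓt+u)) (pos-*+ qℓ t u))
        where
        double : ∀ k → k + k ≡ 2 * k
        double = ℕ-Ring.solve-∀
      cassini : (+ u *ℤ + a +ℤ + b) *ℤ + b -ℤ + a *ℤ + a ≡ -1ℤ ^ suc i
      cassini = trans (cong (λ x → x *ℤ + b -ℤ + a *ℤ + a) (sym (pos-*+ u a b))) (Q-cassini i i≤ℓ)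

    norm-shift : ∀ m → norm (m + L) ≡ -1ℤ ^ L *ℤ norm m
    norm-shift m = ℤ.*-cancelˡ-≡ (+ qℓ) (norm (m + L)) (-1ℤ ^ L *ℤ norm m) (begin
      + qℓ *ℤ norm (m + L)              ≡⟨ form≡qℓ*norm (m + L) ⟨
      form (m + L)                      ≡⟨ form-shift m ⟩
      -1ℤ ^ L *ℤ form m                 ≡⟨ cong (-1ℤ ^ L *ℤ_) (form≡qℓ*norm m) ⟩
      -1ℤ ^ L *ℤ (+ qℓ *ℤ norm m)       ≡⟨ swap (-1ℤ ^ L) (+ qℓ) (norm m) ⟩
      + qℓ *ℤ (-1ℤ ^ L *ℤ norm m)       ∎)
      where
      open ≡-Reasoning
      swap : ∀ x y z → x *ℤ (y *ℤ z) ≡ y *ℤ (x *ℤ z)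
      swap = ℤ-Ring.solve-∀
      form≡qℓ*norm : ∀ m → form m ≡ + qℓ *ℤ norm m
      form≡qℓ*norm m = begin
        form m
          ≡⟨ form-ℤ m ⟩
        + qℓ *ℤ (+ P′ m *ℤ + P′ m) -ℤ + N *ℤ (+ Q′ m *ℤ + Q′ m)
          ≡⟨ cong (λ n → + qℓ *ℤ (+ P′ m *ℤ + P′ m) -ℤ n *ℤ (+ Q′ m *ℤ + Q′ m))
                  (trans (cong +_ N≡qℓ*D₀) (ℤ.pos-* qℓ D₀)) ⟩
        + qℓ *ℤ (+ P′ m *ℤ + P′ m) -ℤ (+ qℓ *ℤ + D₀) *ℤ (+ Q′ m *ℤ + Q′ m)
          ≡⟨ factor (+ qℓ) (+ D₀) (+ P′ m *ℤ + P′ m) (+ Q′ m *ℤ + Q′ m) ⟩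
        + qℓ *ℤ (+ P′ m *ℤ + P′ m -ℤ + D₀ *ℤ (+ Q′ m *ℤ + Q′ m))
          ≡⟨ cong (+ qℓ *ℤ_) (norm-ℤ m) ⟨
        + qℓ *ℤ norm m
          ∎
        where
        factor : ∀ q d x y → q *ℤ x -ℤ (q *ℤ d) *ℤ y ≡ q *ℤ (x -ℤ d *ℤ y)
        factor = ℤ-Ring.solve-∀

    signed-norm : ℕ → ℤ
    signed-norm j = -1ℤ ^ suc j *ℤ norm (suc j)

    signed-norm-periodic : ∀ j → signed-norm (j + L) ≡ signed-norm j
    signed-norm-periodic j = begin
      -1ℤ ^ (suc j + L) *ℤ norm (suc j + L)
        ≡⟨ cong₂ _*ℤ_ (ℤ.^-distribˡ-+-* -1ℤ (suc j) L) (norm-shift (suc j)) ⟩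
      (-1ℤ ^ suc j *ℤ -1ℤ ^ L) *ℤ (-1ℤ ^ L *ℤ norm (suc j))
        ≡⟨ regroup (-1ℤ ^ suc j) (-1ℤ ^ L) (norm (suc j)) ⟩
      (-1ℤ ^ L *ℤ -1ℤ ^ L) *ℤ signed-norm j
        ≡⟨ cong (_*ℤ signed-norm j) (-1^n*-1^n≡1 L) ⟩
      1ℤ *ℤ signed-norm j
        ≡⟨ ℤ.*-identityˡ (signed-norm j) ⟩
      signed-norm j
        ∎
      where
      open ≡-Reasoning
      regroup : ∀ s σ x → (s *ℤ σ) *ℤ (σ *ℤ x) ≡ (σ *ℤ σ) *ℤ (s *ℤ x)
      regroup = ℤ-Ring.solve-∀

    signed-norm-nonneg : ∀ j → 0ℤ ≤ℤ signed-norm j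
    signed-norm-nonneg j = subst (0ℤ ≤ℤ_) (sym (periodic-mod signed-norm L signed-norm-periodic j))
                                 (firstPeriod (j % L) (ℕ.≤-pred (m%n<n j L)))
      where
      firstPeriod : ∀ j → j ≤ ℓ → 0ℤ ≤ℤ signed-norm j
      firstPeriod j j≤ℓ = subst (0ℤ ≤ℤ_) (sym (begin
        -1ℤ ^ suc j *ℤ norm (suc j)
          ≡⟨ cong (-1ℤ ^ suc j *ℤ_) (norm-formula j j≤ℓ) ⟩
        -1ℤ ^ suc j *ℤ (-1ℤ ^ suc j *ℤ + T)
          ≡⟨ ℤ.*-assoc (-1ℤ ^ suc j) (-1ℤ ^ suc j) (+ T) ⟨
        (-1ℤ ^ suc j *ℤ -1ℤ ^ suc j) *ℤ + T
          ≡⟨ cong (_*ℤ + T) (-1^n*-1^n≡1 (suc j)) ⟩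
        1ℤ *ℤ + T
          ≡⟨ ℤ.*-identityˡ (+ T) ⟩
        + T
          ∎)) (+≤+ z≤n)
        where
        open ≡-Reasoning
        T : ℕ
        T = t * Q′ (suc j) * Q′ (ℓ ∸ j) + 1

    D₀-isSqrt : CFIsSqrt k u ℓ D₀
    D₀-isSqrt i = 0≤-pos-diff⇒≤ (subst (0ℤ ≤ℤ_) below (signed-norm-nonneg (2 * i)))
                , 0≤pos-diff⇒≤ (subst (0ℤ ≤ℤ_) above (signed-norm-nonneg (suc (2 * i))))
      where
      below : signed-norm (2 * i) ≡ -1ℤ *ℤ norm (1 + 2 * i)
      below = cong (λ s → -1ℤ *ℤ s *ℤ norm (1 + 2 * i)) (-1^[2n]≡1 i)
      above : signed-norm (suc (2 * i)) ≡ norm (2 + 2 * i)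
      above = trans (cong (λ s → -1ℤ *ℤ (-1ℤ *ℤ s) *ℤ norm (2 + 2 * i)) (-1^[2n]≡1 i)) (ℤ.*-identityˡ _)

proposition4p3 : (k u ℓ : ℕ) → 1 ≤ k → 1 ≤ u → 1 ≤ ℓ →
    ((Σ ℕ (λ D → CFIsSqrt k u ℓ D)) ⇔ (q k u ℓ ℓ ∣ k * p k u ℓ ℓ + P k u ℓ ℓ))
    × ((t : ℕ) → u % 2 ≡ q k u ℓ ℓ % 2 → 1 ≤ t → (u % 2 ≡ 1 → t % 2 ≡ 1) →
        2 * k ≡ q k u ℓ ℓ * t + u →
        (q k u ℓ ℓ ∣ k * p k u ℓ ℓ + P k u ℓ ℓ)
        × ((D : ℕ) → CFIsSqrt k u ℓ D →
            (D ≡ k * k + t * Q k u ℓ ℓ + 1)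
            × (4 * D ≡ t * t * (q k u ℓ ℓ * q k u ℓ ℓ) + 2 * t * (u * q k u ℓ ℓ + 2 * Q k u ℓ ℓ) + u * u + 4)
            × ((i : ℕ) → i ≤ ℓ →
                (+ (p k u ℓ i * p k u ℓ i)) -ℤ (+ (D * (q k u ℓ i * q k u ℓ i)))
                  ≡ (-1ℤ ^ suc i) *ℤ (+ (t * q k u ℓ i * Q k u ℓ (ℓ ∸ i) + 1)))))
proposition4p3 k u zero    _   _   ()
proposition4p3 k u (suc l) k≥1 u≥1 _ =
    mk⇔ (λ (D , isSqrt) → divides D (sym (D*qℓ≡N {D} isSqrt)))
        (λ qℓ∣N → let t , 2k≡qℓt+u = offset-exists qℓ∣N in
                  ClosedForm.D₀ t 2k≡qℓt+u , ClosedForm.D₀-isSqrt t 2k≡qℓt+u)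
  , λ t _ _ _ 2k≡qℓt+u → let open ClosedForm t 2k≡qℓt+u in
      divides D₀ (trans N≡qℓ*D₀ (ℕ.*-comm qℓ D₀)) ,
      λ D isSqrt → case sqrt-unique {D} isSqrt of λ where
        refl → refl , four-D₀ , norm-formula
  where open PeriodicExpansion k u l k≥1 u≥1
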